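{- Let $\delta\in(0,1)$, let $\mathcal{C}:\{\pm1\}^k\to\{\pm1\}^n$ be a $(3,\delta)$-strong LDC with triple sets $M_1,\dots,M_k$, let $H$ be its recovery hypergraph and $G$ its signature graph. Let $J$ be an even subgraph of $G$, i.e. $\deg_J(x)$ is even for every $x\in V(J)$. Then $H_J$ is an even augmentation of $H$.
   Context: A $(3,\delta)$-strong LDC is a map $\mathcal{C}:\{\pm1\}^k\to\{\pm1\}^n$ such that for every $i\in[k]$ there is a set $M_i$ of at least $\delta n$ pairwise disjoint $3$-element subsets of $[n]$ with $x_i=\mathcal{C}(x)_{j_1}\mathcal{C}(x)_{j_2}\mathcal{C}(x)_{j_3}$ for all $x\in\{\pm1\}^k$ and all $\{j_1,j_2,j_3\}\in M_i$; moreover for $i\ne i'$ a triple of $M_i$ and a triple of $M_{i'}$ share at most one element. The recovery hypergraph $H$ has vertex set $[n]$ and edge set $\bigcup_i M_i$; it is linear (two distinct hyperedges share at most one vertex). The signature graph $G$ has vertex set $\{(u,v): u,v\in[n],\ u\neq v\}$, and $(u_1,v_1),(u_2,v_2)$ are adjacent iff $\{u_1,v_1\}\cap\{u_2,v_2\}=\emptyset$ and there is $w\in[n]$ with $\{u_1,u_2,w\},\{v_1,v_2,w\}\in E(H)$; by linearity such $w$ is unique, and for the edge $e$ we set $T(e)=\{\{u_1,u_2,w\},\{v_1,v_2,w\}\}$. An augmentation of $H$ is a hypergraph on $[n]$ whose edge set is a multiset of hyperedges of $H$; it is even if every vertex has even degree counted with multiplicity. For a subgraph $J$ of $G$, $H_J$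 is the augmentation of $H$ on vertex set $[n]$ whose edge multiset is the multiset union $\biguplus_{e\in E(J)}T(e)$ (retaining repeated hyperedges).
   Formalization: The parameter δ ranges over the rationals in the interval (0,1). -}

module Defs where

open import Data.Nat using (ℕ; zero; suc; _+_; _≤_)
open import Data.Nat.Divisibility using (_∣_)
open import Data.Bool using (Bool; true; false; _xor_; _∧_; if_then_else_)
open import Data.Fin using (Fin)
open import Data.Fin.Properties using (_≟_)
open import Data.Fin.Subset using (Subset; ⁅_⁆; _∪_; _∩_; ∣_∣; ⊥)
open import Data.Vec using (Vec; tabulate; zipWith; toList; lookup)
open import Data.List using (List; []; _∷_; foldr; concatMap; map; length)
open import Data.Nat.ListAction using (sum)
open import Data.List.Membership.Propositional using (_∈_)
open import Data.List.Relation.Unary.All using (All)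
open import Data.List.Relation.Unary.AllPairs using (AllPairs)
open import Data.Product using (Σ; _×_; _,_; proj₁; proj₂)
open import Data.Integer using (+_)
open import Data.Rational using (ℚ; 0ℚ; 1ℚ; _/_) renaming (_<_ to _<ℚ_; _≤_ to _≤ℚ_; _*_ to _*ℚ_)
open import Relation.Binary.PropositionalEquality using (_≡_; _≢_)
open import Relation.Nullary using (¬_)
open import Relation.Nullary.Decidable using (⌊_⌋)

-- Conventions.
-- The sign set {±1} is encoded by Bool: false ↦ +1, true ↦ -1.
-- Under this encoding multiplication of signs is _xor_.
-- A subset of [n] is a Data.Fin.Subset n (a Vec Bool n).

ℕ→ℚ : ℕ → ℚ
ℕ→ℚ m = (+ m) / 1

prodOver : {n : ℕ} → (Fin n → Bool) → Subset n → Bool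
prodOver c t = foldr _xor_ false (toList (zipWith _∧_ t (tabulate c)))

tri : {n : ℕ} → Fin n → Fin n → Fin n → Subset n
tri a b c = ⁅ a ⁆ ∪ ⁅ b ⁆ ∪ ⁅ c ⁆

record IsStrongLDC3 {k n : ℕ} (δ : ℚ)
       (C : (Fin k → Bool) → (Fin n → Bool))
       (M : Fin k → List (Subset n)) : Set where
  field
    card3    : ∀ i → All (λ t → ∣ t ∣ ≡ 3) (M i)
    -- the elements of M i are pairwise disjoint (hence pairwise distinct, so
    -- the list represents a set of |M i| triples)
    disjoint : ∀ i → AllPairs (λ t t' → t ∩ t' ≡ ⊥) (M i)
    large    : ∀ i → δ *ℚ ℕ→ℚ n ≤ℚ ℕ→ℚ (length (M i))
    decode   : ∀ i (x : Fin k → Bool) {t : Subset n} → t ∈ M i → x i ≡ prodOver (C x) t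
    cross    : ∀ i i' {t t' : Subset n} → i ≢ i' → t ∈ M i → t' ∈ M i' → ∣ t ∩ t' ∣ ≤ 1

HEdge : {k n : ℕ} → (Fin k → List (Subset n)) → Subset n → Set
HEdge {k} M t = Σ (Fin k) λ i → t ∈ M i

GVert : ℕ → Set
GVert n = Fin n × Fin n

IsGVert : {n : ℕ} → GVert n → Set
IsGVert (u , v) = u ≢ v

-- adjacency of (u1,v1) and (u2,v2) in G, together with the witness w
-- (unique by linearity of H).
Adj : {k n : ℕ} → (Fin k → List (Subset n)) → GVert n → GVert n → Set
Adj {n = n} M (u₁ , v₁) (u₂ , v₂) =
  IsGVert (u₁ , v₁) × IsGVert (u₂ , v₂) ×
  (u₁ ≢ u₂) × (u₁ ≢ v₂) × (v₁ ≢ u₂) × (v₁ ≢ v₂) ×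
  Σ (Fin n) λ w → HEdge M (tri u₁ u₂ w) × HEdge M (tri v₁ v₂ w)

GEdge : {k n : ℕ} → (Fin k → List (Subset n)) → Set
GEdge {n = n} M = Σ (GVert n × GVert n) λ xy → Adj M (proj₁ xy) (proj₂ xy)

SameEdge : {k n : ℕ} {M : Fin k → List (Subset n)} → GEdge M → GEdge M → Set
SameEdge ((x , y) , _) ((x' , y') , _) =
  ((x ≡ x') × (y ≡ y')) Data.Sum.⊎ ((x ≡ y') × (y ≡ x'))
  where import Data.Sum

-- a subgraph J of G, given by its edge set: a list of edges of G with no
-- edge listed twice (isolated vertices of J are irrelevant to degrees)
record Subgraph {k n : ℕ} (M : Fin k → List (Subset n)) : Set where
  field
    edges    : List (GEdge M)
    distinct : AllPairs (λ e e' → ¬ SameEdge e e') edges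
open Subgraph public

_=ᵥ_ : {n : ℕ} → GVert n → GVert n → Bool
(u , v) =ᵥ (a , b) = ⌊ u ≟ a ⌋ ∧ ⌊ v ≟ b ⌋

degJ : {k n : ℕ} {M : Fin k → List (Subset n)} → Subgraph M → GVert n → ℕ
degJ J x = sum (map (λ e → if (proj₁ (proj₁ e) =ᵥ x) then 1
                           else if (proj₂ (proj₁ e) =ᵥ x) then 1 else 0) (edges J))

EvenSubgraph : {k n : ℕ} {M : Fin k → List (Subset n)} → Subgraph M → Set
EvenSubgraph {n = n} J = (x : GVert n) → 2 ∣ degJ J x

T : {k n : ℕ} {M : Fin k → List (Subset n)} → GEdge M → List (Subset n)
T (((u₁ , v₁) , (u₂ , v₂)) , (_ , _ , _ , _ , _ , _ , w , _)) =
  tri u₁ u₂ w ∷ tri v₁ v₂ w ∷ []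

-- H_J: the augmentation of H whose edge multiset is ⨄_{e ∈ E(J)} T(e)
-- (a list of hyperedges, repetitions retained)
H[_] : {k n : ℕ} {M : Fin k → List (Subset n)} → Subgraph M → List (Subset n)
H[ J ] = concatMap T (edges J)

-- Augmentations: a multiset (list) of hyperedges of H on vertex set [n].

IsAugmentation : {k n : ℕ} → (Fin k → List (Subset n)) → List (Subset n) → Set
IsAugmentation M A = All (HEdge M) A

degA : {n : ℕ} → List (Subset n) → Fin n → ℕ
degA A z = sum (map (λ t → if lookup t z then 1 else 0) A)

IsEvenAugmentation : {k n : ℕ} → (Fin k → List (Subset n)) → List (Subset n) → Set
IsEvenAugmentation {n = n} M A = IsAugmentation M A × ((z : Fin n) → 2 ∣ degA A z)

-- The degree of a vertex z in H_J is a sum over the edges e of J. If e joins (u₁,v₁)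
-- and (u₂,v₂) through the apex w, then z lies in {u₁,u₂,w} and {v₁,v₂,w} together
-- 2[z = w] + [z = u₁] + [z = u₂] + [z = v₁] + [z = v₂] times, since 3-uniformity makes
-- the points of each triple distinct. Summed over E(J), the bracket [z = u₁] + [z = u₂]
-- adds up to Σ_b deg_J(z,b), and [z = v₁] + [z = v₂] to Σ_a deg_J(a,z), so
-- deg_{H_J}(z) = 2 · #{e : apex e = z} + Σ_b deg_J(z,b) + Σ_a deg_J(a,z), which is even.
module Submission where

open import Defs
open import Data.Nat using (ℕ; zero; suc; _+_; _*_; _≤_; z≤n; s≤s)
open import Data.Nat.Properties using (+-0-commutativeMonoid; ≤-trans; ≤-reflexive; +-monoʳ-≤; n≤1+n; +-suc)
open import Data.Nat.Divisibility using (_∣_; _∣0; ∣m∣n⇒∣m+n; m∣m*n)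
open import Data.Nat.ListAction using (sum)
open import Data.Nat.ListAction.Properties using (sum-++)
open import Data.Nat.Tactic.RingSolver using (solve-∀)
open import Algebra.Properties.CommutativeMonoid.Sum +-0-commutativeMonoid
  using (sum-syntax; ∑-distrib-+; sum-cong-≗; sum-replicate-zero)
open import Data.Bool using (Bool; true; false; _∧_; _∨_; if_then_else_)
open import Data.Bool.Properties using (∧-comm; ∧-distribˡ-∨)
open import Data.Fin using (Fin)
import Data.Fin as Fin
open import Data.Fin.Properties using (_≟_)
open import Data.Fin.Subset using (Subset; ⁅_⁆; _∪_; ∣_∣; outside)
open import Data.Fin.Subset.Properties using (∪-assoc; ∪-comm; ∪-idem; ∣⁅x⁆∣≡1)
open import Data.Vec using ([]; _∷_; lookup)
open import Data.Vec.Properties using (lookup-zipWith; lookup-replicate)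
open import Data.List using (List; []; _∷_; _++_; concatMap; map)
open import Data.List.Properties using (map-++)
open import Data.List.Relation.Unary.All using (All; universal)
import Data.List.Relation.Unary.All as All
open import Data.List.Relation.Unary.All.Properties using (concat⁺; map⁺)
open import Data.Product using (_×_; _,_; proj₁; proj₂)
open import Data.Rational using (ℚ; 0ℚ; 1ℚ; _<_)
open import Relation.Binary.PropositionalEquality
open import Relation.Nullary using (yes; no; contradiction)
open import Relation.Nullary.Decidable using (⌊_⌋)
open import Function using (_∘_)

𝟙 : Bool → ℕ
𝟙 b = if b then 1 else 0

𝟙-∨-disjoint : ∀ p q → p ∧ q ≡ false → 𝟙 (p ∨ q) ≡ 𝟙 p + 𝟙 q
𝟙-∨-disjoint true  false _ = refl
𝟙-∨-disjoint false q     _ = refl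

if-1-else-𝟙 : ∀ p q → (if p then 1 else 𝟙 q) ≡ 𝟙 (p ∨ q)
if-1-else-𝟙 true  q = refl
if-1-else-𝟙 false q = refl

_==_ : {n : ℕ} → Fin n → Fin n → Bool
a == b = ⌊ a ≟ b ⌋

==-suc : {n : ℕ} (a b : Fin n) → (Fin.suc a == Fin.suc b) ≡ (a == b)
==-suc a b with a ≟ b
... | yes _ = refl
... | no  _ = refl

==-exclusive : {n : ℕ} {a b : Fin n} (z : Fin n) → a ≢ b → (a == z) ∧ (b == z) ≡ false
==-exclusive {a = a} {b} z a≢b with a ≟ z | b ≟ z
... | yes refl | yes refl = contradiction refl a≢b
... | yes _    | no _     = refl
... | no _     | _        = refl

∑-𝟙-== : {n : ℕ} (a : Fin n) → ∑[ b < n ] 𝟙 (a == b) ≡ 1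
∑-𝟙-== {suc n} Fin.zero    = cong suc (sum-replicate-zero n)
∑-𝟙-== {suc n} (Fin.suc a) = trans (sum-cong-≗ (cong 𝟙 ∘ ==-suc a)) (∑-𝟙-== a)

∑-𝟙-∧-== : {n : ℕ} (c : Bool) (a : Fin n) → ∑[ b < n ] 𝟙 (c ∧ (a == b)) ≡ 𝟙 c
∑-𝟙-∧-== {n} false a = sum-replicate-zero n
∑-𝟙-∧-== true  a     = ∑-𝟙-== a

∑-𝟙-=ᵥ-row : {n : ℕ} {u₁ u₂ : Fin n} (v₁ v₂ z : Fin n) → u₁ ≢ u₂ →
  ∑[ b < n ] 𝟙 (((u₁ , v₁) =ᵥ (z , b)) ∨ ((u₂ , v₂) =ᵥ (z , b))) ≡ 𝟙 (u₁ == z) + 𝟙 (u₂ == z)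
∑-𝟙-=ᵥ-row {n} {u₁} {u₂} v₁ v₂ z u₁≢u₂ = begin
  ∑[ b < n ] 𝟙 (p₁ b ∨ p₂ b)         ≡⟨ sum-cong-≗ (λ b → 𝟙-∨-disjoint (p₁ b) (p₂ b) (exclusive b)) ⟩
  ∑[ b < n ] (𝟙 (p₁ b) + 𝟙 (p₂ b))   ≡⟨ ∑-distrib-+ (𝟙 ∘ p₁) (𝟙 ∘ p₂) ⟩
  ∑[ b < n ] 𝟙 (p₁ b) + ∑[ b < n ] 𝟙 (p₂ b)
    ≡⟨ cong₂ _+_ (∑-𝟙-∧-== (u₁ == z) v₁) (∑-𝟙-∧-== (u₂ == z) v₂) ⟩
  𝟙 (u₁ == z) + 𝟙 (u₂ == z)          ∎
  where
  open ≡-Reasoning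
  p₁ p₂ : Fin n → Bool
  p₁ b = (u₁ , v₁) =ᵥ (z , b)
  p₂ b = (u₂ , v₂) =ᵥ (z , b)
  exclusive : ∀ b → p₁ b ∧ p₂ b ≡ false
  exclusive b with u₁ ≟ z | u₂ ≟ z
  ... | yes refl | yes refl = contradiction refl u₁≢u₂
  ... | yes _    | no _     = ∧-comm (v₁ == b) false
  ... | no _     | _        = refl

∑-𝟙-=ᵥ-col : {n : ℕ} {v₁ v₂ : Fin n} (u₁ u₂ z : Fin n) → v₁ ≢ v₂ →
  ∑[ a < n ] 𝟙 (((u₁ , v₁) =ᵥ (a , z)) ∨ ((u₂ , v₂) =ᵥ (a , z))) ≡ 𝟙 (v₁ == z) + 𝟙 (v₂ == z)
∑-𝟙-=ᵥ-col {v₁ = v₁} {v₂} u₁ u₂ z v₁≢v₂ =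
  trans (sum-cong-≗ λ a → cong₂ (λ p q → 𝟙 (p ∨ q)) (∧-comm (u₁ == a) (v₁ == z)) (∧-comm (u₂ == a) (v₂ == z)))
        (∑-𝟙-=ᵥ-row u₁ u₂ z v₁≢v₂)

lookup-⁅⁆ : {n : ℕ} (a z : Fin n) → lookup ⁅ a ⁆ z ≡ (a == z)
lookup-⁅⁆ Fin.zero    Fin.zero    = refl
lookup-⁅⁆ Fin.zero    (Fin.suc z) = lookup-replicate z outside
lookup-⁅⁆ (Fin.suc a) Fin.zero    = refl
lookup-⁅⁆ (Fin.suc a) (Fin.suc z) = trans (lookup-⁅⁆ a z) (sym (==-suc a z))

lookup-tri : {n : ℕ} (a b c z : Fin n) → lookup (tri a b c) z ≡ (a == z) ∨ ((b == z) ∨ (c == z))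
lookup-tri a b c z = begin
  lookup (⁅ a ⁆ ∪ (⁅ b ⁆ ∪ ⁅ c ⁆)) z                   ≡⟨ lookup-zipWith _∨_ z ⁅ a ⁆ (⁅ b ⁆ ∪ ⁅ c ⁆) ⟩
  lookup ⁅ a ⁆ z ∨ lookup (⁅ b ⁆ ∪ ⁅ c ⁆) z           ≡⟨ cong (lookup ⁅ a ⁆ z ∨_) (lookup-zipWith _∨_ z ⁅ b ⁆ ⁅ c ⁆) ⟩
  lookup ⁅ a ⁆ z ∨ (lookup ⁅ b ⁆ z ∨ lookup ⁅ c ⁆ z)  ≡⟨ cong₂ _∨_ (lookup-⁅⁆ a z) (cong₂ _∨_ (lookup-⁅⁆ b z) (lookup-⁅⁆ c z)) ⟩
  (a == z) ∨ ((b == z) ∨ (c == z))                    ∎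
  where open ≡-Reasoning

𝟙-lookup-tri : {n : ℕ} {a b c : Fin n} (z : Fin n) → a ≢ b → a ≢ c → b ≢ c →
  𝟙 (lookup (tri a b c) z) ≡ 𝟙 (a == z) + (𝟙 (b == z) + 𝟙 (c == z))
𝟙-lookup-tri {a = a} {b} {c} z a≢b a≢c b≢c = begin
  𝟙 (lookup (tri a b c) z)                        ≡⟨ cong 𝟙 (lookup-tri a b c z) ⟩
  𝟙 ((a == z) ∨ ((b == z) ∨ (c == z)))            ≡⟨ 𝟙-∨-disjoint (a == z) _ a-excl ⟩
  𝟙 (a == z) + 𝟙 ((b == z) ∨ (c == z))            ≡⟨ cong (𝟙 (a == z) +_) (𝟙-∨-disjoint (b == z) (c == z) (==-exclusive z b≢c)) ⟩
  𝟙 (a == z) + (𝟙 (b == z) + 𝟙 (c == z))          ∎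
  where
  open ≡-Reasoning
  a-excl : (a == z) ∧ ((b == z) ∨ (c == z)) ≡ false
  a-excl = trans (∧-distribˡ-∨ (a == z) (b == z) (c == z))
                 (cong₂ _∨_ (==-exclusive z a≢b) (==-exclusive z a≢c))

∣p∪q∣≤∣p∣+∣q∣ : {n : ℕ} (p q : Subset n) → ∣ p ∪ q ∣ ≤ ∣ p ∣ + ∣ q ∣
∣p∪q∣≤∣p∣+∣q∣ []            []            = z≤n
∣p∪q∣≤∣p∣+∣q∣ (true  ∷ p)   (true  ∷ q)   = s≤s (≤-trans (∣p∪q∣≤∣p∣+∣q∣ p q) (+-monoʳ-≤ ∣ p ∣ (n≤1+n ∣ q ∣)))
∣p∪q∣≤∣p∣+∣q∣ (true  ∷ p)   (false ∷ q)   = s≤s (∣p∪q∣≤∣p∣+∣q∣ p q)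
∣p∪q∣≤∣p∣+∣q∣ (false ∷ p)   (true  ∷ q)   = ≤-trans (s≤s (∣p∪q∣≤∣p∣+∣q∣ p q)) (≤-reflexive (sym (+-suc ∣ p ∣ ∣ q ∣)))
∣p∪q∣≤∣p∣+∣q∣ (false ∷ p)   (false ∷ q)   = ∣p∪q∣≤∣p∣+∣q∣ p q

∣⁅a⁆∪⁅b⁆∣≤2 : {n : ℕ} (a b : Fin n) → ∣ ⁅ a ⁆ ∪ ⁅ b ⁆ ∣ ≤ 2
∣⁅a⁆∪⁅b⁆∣≤2 a b = ≤-trans (∣p∪q∣≤∣p∣+∣q∣ ⁅ a ⁆ ⁅ b ⁆) (≤-reflexive (cong₂ _+_ (∣⁅x⁆∣≡1 a) (∣⁅x⁆∣≡1 b)))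

tri-distinct : {n : ℕ} (a b c : Fin n) → ∣ tri a b c ∣ ≡ 3 → (a ≢ c) × (b ≢ c)
tri-distinct a b _ ∣t∣≡3 = a≢c , b≢c
  where
  two-points : ∀ {t} → t ≡ ⁅ a ⁆ ∪ ⁅ b ⁆ → ∣ t ∣ ≢ 3
  two-points refl ∣t∣≡3 = contradiction (subst (_≤ 2) ∣t∣≡3 (∣⁅a⁆∪⁅b⁆∣≤2 a b)) λ { (s≤s (s≤s ())) }
  a≢c : a ≢ _
  a≢c refl = two-points (begin
    ⁅ a ⁆ ∪ (⁅ b ⁆ ∪ ⁅ a ⁆)   ≡⟨ cong (⁅ a ⁆ ∪_) (∪-comm ⁅ b ⁆ ⁅ a ⁆) ⟩
    ⁅ a ⁆ ∪ (⁅ a ⁆ ∪ ⁅ b ⁆)   ≡⟨ ∪-assoc ⁅ a ⁆ ⁅ a ⁆ ⁅ b ⁆ ⟨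
    (⁅ a ⁆ ∪ ⁅ a ⁆) ∪ ⁅ b ⁆   ≡⟨ cong (_∪ ⁅ b ⁆) (∪-idem ⁅ a ⁆) ⟩
    ⁅ a ⁆ ∪ ⁅ b ⁆             ∎) ∣t∣≡3
    where open ≡-Reasoning
  b≢c : b ≢ _
  b≢c refl = two-points (cong (⁅ a ⁆ ∪_) (∪-idem ⁅ b ⁆)) ∣t∣≡3

degA-++ : {n : ℕ} (A B : List (Subset n)) (z : Fin n) → degA (A ++ B) z ≡ degA A z + degA B z
degA-++ A B z = trans (cong sum (map-++ (λ t → 𝟙 (lookup t z)) A B)) (sum-++ (map _ A) (map _ B))

∣-∑ : {d n : ℕ} (f : Fin n → ℕ) → (∀ i → d ∣ f i) → d ∣ ∑[ i < n ] f i
∣-∑ {d} {zero}  f d∣f = d ∣0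
∣-∑ {d} {suc n} f d∣f = ∣m∣n⇒∣m+n (d∣f Fin.zero) (∣-∑ (f ∘ Fin.suc) (d∣f ∘ Fin.suc))

module _ {k n : ℕ} {M : Fin k → List (Subset n)} where

  apex : GEdge M → Fin n
  apex (_ , (_ , _ , _ , _ , _ , _ , w , _)) = w

  -- Spelled exactly as the summand of degJ, so that degree (edges J) is degJ J by definition.
  incidence : GEdge M → GVert n → ℕ
  incidence e x = if (proj₁ (proj₁ e) =ᵥ x) then 1 else if (proj₂ (proj₁ e) =ᵥ x) then 1 else 0

  degree : List (GEdge M) → GVert n → ℕ
  degree L x = sum (map (λ e → incidence e x) L)

  apexCount : List (GEdge M) → Fin n → ℕ
  apexCount L z = sum (map (λ e → 𝟙 (apex e == z)) L)

  T-⊆-H : (e : GEdge M) → All (HEdge M) (T e)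
  T-⊆-H (_ , (_ , _ , _ , _ , _ , _ , _ , h₁ , h₂)) = h₁ All.∷ h₂ All.∷ All.[]

  H[]-isAugmentation : (J : Subgraph M) → IsAugmentation M H[ J ]
  H[]-isAugmentation J = concat⁺ (map⁺ (universal T-⊆-H (edges J)))

  module _ (3-uniform : ∀ {t} → HEdge M t → ∣ t ∣ ≡ 3) where

    degA-T : (e : GEdge M) (z : Fin n) →
      degA (T e) z ≡ 2 * 𝟙 (apex e == z) + (∑[ b < n ] incidence e (z , b) + ∑[ a < n ] incidence e (a , z))
    degA-T e@(((u₁ , v₁) , (u₂ , v₂)) , (_ , _ , u₁≢u₂ , _ , _ , v₁≢v₂ , w , h₁ , h₂)) z = begin
      𝟙 (lookup (tri u₁ u₂ w) z) + (𝟙 (lookup (tri v₁ v₂ w) z) + 0)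
        ≡⟨ cong₂ (λ p q → p + (q + 0)) (𝟙-lookup-tri z u₁≢u₂ u₁≢w u₂≢w) (𝟙-lookup-tri z v₁≢v₂ v₁≢w v₂≢w) ⟩
      (𝟙 (u₁ == z) + (𝟙 (u₂ == z) + 𝟙 (w == z))) + ((𝟙 (v₁ == z) + (𝟙 (v₂ == z) + 𝟙 (w == z))) + 0)
        ≡⟨ regroup (𝟙 (u₁ == z)) (𝟙 (u₂ == z)) (𝟙 (v₁ == z)) (𝟙 (v₂ == z)) (𝟙 (w == z)) ⟩
      2 * 𝟙 (w == z) + ((𝟙 (u₁ == z) + 𝟙 (u₂ == z)) + (𝟙 (v₁ == z) + 𝟙 (v₂ == z)))
        ≡⟨ cong (2 * 𝟙 (w == z) +_) (cong₂ _+_ row col) ⟨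
      2 * 𝟙 (w == z) + (∑[ b < n ] incidence e (z , b) + ∑[ a < n ] incidence e (a , z)) ∎
      where
      open ≡-Reasoning
      u₁≢w : u₁ ≢ w
      u₁≢w = proj₁ (tri-distinct u₁ u₂ w (3-uniform h₁))
      u₂≢w : u₂ ≢ w
      u₂≢w = proj₂ (tri-distinct u₁ u₂ w (3-uniform h₁))
      v₁≢w : v₁ ≢ w
      v₁≢w = proj₁ (tri-distinct v₁ v₂ w (3-uniform h₂))
      v₂≢w : v₂ ≢ w
      v₂≢w = proj₂ (tri-distinct v₁ v₂ w (3-uniform h₂))
      regroup : ∀ a b c d x → (a + (b + x)) + ((c + (d + x)) + 0) ≡ 2 * x + ((a + b) + (c + d))
      regroup = solve-∀
      row : ∑[ b < n ] incidence e (z , b) ≡ 𝟙 (u₁ == z) + 𝟙 (u₂ == z)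
      row = trans (sum-cong-≗ λ b → if-1-else-𝟙 ((u₁ , v₁) =ᵥ (z , b)) ((u₂ , v₂) =ᵥ (z , b))) (∑-𝟙-=ᵥ-row v₁ v₂ z u₁≢u₂)
      col : ∑[ a < n ] incidence e (a , z) ≡ 𝟙 (v₁ == z) + 𝟙 (v₂ == z)
      col = trans (sum-cong-≗ λ a → if-1-else-𝟙 ((u₁ , v₁) =ᵥ (a , z)) ((u₂ , v₂) =ᵥ (a , z))) (∑-𝟙-=ᵥ-col u₁ u₂ z v₁≢v₂)

    degA-concatMap-T : (L : List (GEdge M)) (z : Fin n) →
      degA (concatMap T L) z ≡ 2 * apexCount L z + (∑[ b < n ] degree L (z , b) + ∑[ a < n ] degree L (a , z))
    degA-concatMap-T []      z = sym (cong₂ _+_ (sum-replicate-zero n) (sum-replicate-zero n))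
    degA-concatMap-T (e ∷ L) z = begin
      degA (T e ++ concatMap T L) z
        ≡⟨ degA-++ (T e) (concatMap T L) z ⟩
      degA (T e) z + degA (concatMap T L) z
        ≡⟨ cong₂ _+_ (degA-T e z) (degA-concatMap-T L z) ⟩
      (2 * x + (∑ row + ∑ col)) + (2 * X + (∑ Row + ∑ Col))
        ≡⟨ regroup x X (∑ row) (∑ Row) (∑ col) (∑ Col) ⟩
      2 * (x + X) + ((∑ row + ∑ Row) + (∑ col + ∑ Col))
        ≡⟨ cong (2 * (x + X) +_) (cong₂ _+_ (∑-distrib-+ row Row) (∑-distrib-+ col Col)) ⟨
      2 * apexCount (e ∷ L) z + (∑[ b < n ] degree (e ∷ L) (z , b) + ∑[ a < n ] degree (e ∷ L) (a , z)) ∎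
      where
      open ≡-Reasoning
      ∑ : (Fin n → ℕ) → ℕ
      ∑ f = ∑[ i < n ] f i
      x X : ℕ
      x = 𝟙 (apex e == z)
      X = apexCount L z
      row col Row Col : Fin n → ℕ
      row b = incidence e (z , b)
      col a = incidence e (a , z)
      Row b = degree L (z , b)
      Col a = degree L (a , z)
      regroup : ∀ x X r R c C → (2 * x + (r + c)) + (2 * X + (R + C)) ≡ 2 * (x + X) + ((r + R) + (c + C))
      regroup = solve-∀

    H[]-even : (J : Subgraph M) → EvenSubgraph J → (z : Fin n) → 2 ∣ degA H[ J ] z
    H[]-even J even z = subst (2 ∣_) (sym (degA-concatMap-T (edges J) z))
      (∣m∣n⇒∣m+n (m∣m*n (apexCount (edges J) z))
        (∣m∣n⇒∣m+n (∣-∑ _ (λ b → even (z , b))) (∣-∑ _ (λ a → even (a , z)))))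

claim2p3 : {k n : ℕ} (δ : ℚ) → 0ℚ < δ → δ < 1ℚ →
    (C : (Fin k → Bool) → (Fin n → Bool)) (M : Fin k → List (Subset n)) →
    IsStrongLDC3 δ C M →
    (J : Subgraph M) → EvenSubgraph J →
    IsEvenAugmentation M H[ J ]
claim2p3 δ _ _ C M ldc J even = H[]-isAugmentation J , H[]-even 3-uniform J even
  where
  3-uniform : ∀ {t} → HEdge M t → ∣ t ∣ ≡ 3
  3-uniform (i , t∈Mᵢ) = All.lookup (IsStrongLDC3.card3 ldc i) t∈Mᵢ
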